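{- Let $n=p_1^{\alpha_1}p_2^{\alpha_2}\cdots p_k^{\alpha_k}$ be the prime power factorization of a composite integer $n$ (distinct primes $p_i$), with $\alpha_1\ge3$ if $k=1$. Then the diameter of $\Upsilon_n$ is $1$ if $n\in\{p_1^3,p_1p_2\}$; $2$ if $n=p_1^{\alpha_1}$ with $\alpha_1\ge4$; and $3$ otherwise.
   Context: For an integer $n>1$, a proper divisor of $n$ is an integer $d$ with $1<d<n$ and $d\mid n$. The proper divisor graph $\Upsilon_n$ is the simple graph whose vertices are the proper divisors of $n$, two distinct vertices $u,v$ being adjacent iff $n\mid uv$. -}

module Defs where

open import Data.Nat using (ℕ; zero; suc; _*_; _<_; _≤_; _^_)
open import Data.Nat.Divisibility using (_∣_)
open import Data.Product using (Σ; ∃; _×_)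
open import Relation.Binary.PropositionalEquality using (_≡_; _≢_)
open import Relation.Nullary using (¬_)

ProperDivisor : ℕ → ℕ → Set
ProperDivisor n d = 1 < d × d < n × d ∣ n

Adj : ℕ → ℕ → ℕ → Set
Adj n u v = ProperDivisor n u × ProperDivisor n v × u ≢ v × n ∣ u * v

data Walk (n : ℕ) : ℕ → ℕ → ℕ → Set where
  here : ∀ {u} → ProperDivisor n u → Walk n u u 0
  step : ∀ {u w v k} → Adj n u w → Walk n w v k → Walk n u v (suc k)

Dist : ℕ → ℕ → ℕ → ℕ → Set
Dist n u v k = Walk n u v k × (∀ j → j < k → ¬ Walk n u v j)

Diameter : ℕ → ℕ → Set
Diameter n D =
  (∀ u v → ProperDivisor n u → ProperDivisor n v →
     Σ ℕ (λ k → k ≤ D × Dist n u v k))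
  × Σ ℕ (λ u → Σ ℕ (λ v → ProperDivisor n u × ProperDivisor n v × Dist n u v D))

-- For a prime q dividing a vertex u, the cofactor n/q is adjacent to u, since n = (n/q)·q divides
-- u·(n/q); and two distinct cofactors n/q, n/r are adjacent, since q divides n/r unless q = r.
-- So u — n/q — n/r — v joins any two vertices, and when n is a prime power the two cofactors
-- coincide. Conversely two distinct primes p, q dividing n are coprime, so a common neighbour x
-- would satisfy n ∣ x, and they are adjacent only if n = pq; in p^a with a ≥ 4 the vertices
-- p and p² are not adjacent since p³ < p^a. Finally Υ_{p³} and Υ_{pq} are single edges.
module Submission where

open import Defs
open import Data.Nat.Base
  using (ℕ; zero; suc; _*_; _^_; _≤_; _<_; z≤n; s≤s; z<s; NonZero; >-nonZero; nonTrivial⇒n>1)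
open import Data.Nat.Properties
open import Data.Nat.Divisibility
open import Data.Nat.Coprimality as Coprimality using (Coprime; coprime-divisor; coprime-factors)
open import Data.Nat.Primality
  using (Prime; Composite; euclidsLemma; prime⇒irreducible; prime⇒nonZero; prime⇒nonTrivial;
         composite⇒¬prime; composite⇒nonTrivial; composite⇒nonZero)
open import Data.Nat.Primality.Factorisation using (factorise)
open import Data.Nat.ListAction using (product)
open import Data.Nat.Induction using (<-wellFounded)
open import Data.List.Base using ([]; _∷_)
open import Data.List.Relation.Unary.All using (All; []; _∷_)
open import Data.Product using (Σ; ∃; ∃₂; _×_; _,_; proj₁; proj₂)
open import Data.Sum using (_⊎_; inj₁; inj₂)
open import Data.Empty using (⊥; ⊥-elim)
open import Function.Base using (_∘_; case_of_)
open import Induction.WellFounded using (Acc; acc)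
open import Relation.Nullary using (¬_; Dec; yes; no; contradiction)
open import Relation.Nullary.Decidable using (_×-dec_; ¬?; map′)
open import Relation.Unary using (Decidable)
open import Relation.Binary.PropositionalEquality using (_≡_; _≢_; refl; sym; trans; cong; subst)

private
  variable
    n u v w a p q D : ℕ

module _ {P : ℕ → Set} (P? : Decidable P) where

  leastWitness : ∀ k → P k → ∃ λ j → j ≤ k × P j × (∀ i → i < j → ¬ P i)
  leastWitness k = go k (<-wellFounded k)
    where
    go : ∀ k → Acc _<_ k → P k → ∃ λ j → j ≤ k × P j × (∀ i → i < j → ¬ P i)
    go k (acc smaller) Pk with anyUpTo? P? k
    ... | no none = k , ≤-refl , Pk , λ i i<k Pi → none (i , i<k , Pi)
    ... | yes (i , i<k , Pi) with go i (smaller i<k) Pi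
    ...   | j , j≤i , least = j , ≤-trans j≤i (<⇒≤ i<k) , least

walk⇒properDivisor : ∀ {k} → Walk n u v k → ProperDivisor n u
walk⇒properDivisor (here pu) = pu
walk⇒properDivisor (step (pu , _) _) = pu

walk₀⇒≡ : Walk n u v 0 → u ≡ v
walk₀⇒≡ (here _) = refl

walk₁⇒Adj : Walk n u v 1 → Adj n u v
walk₁⇒Adj (step uv (here _)) = uv

walk₂⇒Adj² : Walk n u v 2 → ∃ λ w → Adj n u w × Adj n w v
walk₂⇒Adj² (step uw (step wv (here _))) = _ , uw , wv

properDivisor? : ∀ n d → Dec (ProperDivisor n d)
properDivisor? n d = 1 <? d ×-dec d <? n ×-dec d ∣? n

adj? : ∀ n u v → Dec (Adj n u v)
adj? n u v = properDivisor? n u ×-dec properDivisor? n v ×-dec ¬? (u ≟ v) ×-dec n ∣? u * v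

walk? : ∀ n u v k → Dec (Walk n u v k)
walk? n u v zero with u ≟ v | properDivisor? n u
... | no u≢v   | _      = no (u≢v ∘ walk₀⇒≡)
... | yes refl | yes pu = yes (here pu)
... | yes refl | no ¬pu = no (¬pu ∘ walk⇒properDivisor)
walk? n u v (suc k) =
  map′ (λ { (_ , _ , uw , wv) → step uw wv }) viaNeighbour
       (anyUpTo? (λ w → adj? n u w ×-dec walk? n w v k) n)
  where
  viaNeighbour : Walk n u v (suc k) → ∃ λ w → w < n × Adj n u w × Walk n w v k
  viaNeighbour (step uw wv) = _ , proj₁ (proj₂ (walk⇒properDivisor wv)) , uw , wv

shortestWalk : ∀ {k} → Walk n u v k → ∃ λ j → j ≤ k × Dist n u v j
shortestWalk {n} {u} {v} {k} = leastWitness (walk? n u v) k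

Reachable : ℕ → ℕ → ℕ → ℕ → Set
Reachable n D u v = ∃ λ k → k ≤ D × Walk n u v k

reachable-refl : ProperDivisor n u → Reachable n 0 u u
reachable-refl pu = 0 , z≤n , here pu

-- The step u — w may stay put (u ≡ w): walks through possibly coinciding vertices need no case split.
reachable-cons : ProperDivisor n u → (u ≢ w → n ∣ u * w) → Reachable n D w v →
                 Reachable n (suc D) u v
reachable-cons {u = u} {w = w} pu n∣uw (k , k≤D , wv) with u ≟ w
... | yes refl = k , m≤n⇒m≤1+n k≤D , wv
... | no u≢w   = suc k , s≤s k≤D , step (pu , walk⇒properDivisor wv , u≢w , n∣uw u≢w) wv

mkDiameter : (∀ u v → ProperDivisor n u → ProperDivisor n v → Reachable n D u v) →
             ProperDivisor n u → ProperDivisor n v → (∀ j → j < D → ¬ Walk n u v j) →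
             Diameter n D
mkDiameter {n} {D} {u} {v} reachable pu pv noShorter = bounded , u , v , pu , pv , exact
  where
  bounded : ∀ x y → ProperDivisor n x → ProperDivisor n y → Σ ℕ (λ k → k ≤ D × Dist n x y k)
  bounded x y px py with reachable x y px py
  ... | k , k≤D , xy with shortestWalk xy
  ...   | j , j≤k , dist = j , ≤-trans j≤k k≤D , dist
  exact : Dist n u v D
  exact with reachable u v pu pv
  ... | k , k≤D , uv with ≤-antisym k≤D (≮⇒≥ λ k<D → noShorter k k<D uv)
  ...   | refl = uv , noShorter

singleEdge⇒diameter1 : ∀ {d e} → (∀ {u} → ProperDivisor n u → u ≡ d ⊎ u ≡ e) →
                       ProperDivisor n d → ProperDivisor n e → d ≢ e → n ≡ d * e → Diameter n 1
singleEdge⇒diameter1 {n} {d} {e} vertices pd pe d≢e n≡de =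
  mkDiameter reachable pd pe λ { zero _ → d≢e ∘ walk₀⇒≡ ; (suc _) (s≤s ()) }
  where
  adjacent : ∀ {u v} → u ≡ d ⊎ u ≡ e → v ≡ d ⊎ v ≡ e → u ≢ v → n ∣ u * v
  adjacent (inj₁ refl) (inj₁ refl) u≢v = contradiction refl u≢v
  adjacent (inj₁ refl) (inj₂ refl) _   = ∣-reflexive n≡de
  adjacent (inj₂ refl) (inj₁ refl) _   = ∣-reflexive (trans n≡de (*-comm d e))
  adjacent (inj₂ refl) (inj₂ refl) u≢v = contradiction refl u≢v
  reachable : ∀ u v → ProperDivisor n u → ProperDivisor n v → Reachable n 1 u v
  reachable u v pu pv =
    reachable-cons pu (adjacent (vertices pu) (vertices pv)) (reachable-refl pv)

prime>1 : Prime p → 1 < p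
prime>1 {p} pp = nonTrivial⇒n>1 p {{prime⇒nonTrivial pp}}

prime∣prime⇒≡ : Prime p → Prime q → p ∣ q → p ≡ q
prime∣prime⇒≡ pp pq p∣q with prime⇒irreducible pq p∣q
... | inj₁ refl = contradiction (prime>1 pp) (<-irrefl refl)
... | inj₂ p≡q  = p≡q

prime∤⇒coprime : ∀ {m} → Prime p → ¬ p ∣ m → Coprime m p
prime∤⇒coprime pp p∤m (d∣m , d∣p) with prime⇒irreducible pp d∣p
... | inj₁ d≡1 = d≡1
... | inj₂ refl = contradiction d∣m p∤m

coprime⇒*∣ : Coprime u v → u ∣ n → v ∣ n → u * v ∣ n
coprime⇒*∣ {u} {v} coprime (divides c refl) v∣cu
  with coprime-divisor (Coprimality.sym coprime) (subst (v ∣_) (*-comm c u) v∣cu)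
... | divides d refl = divides d (trans (*-assoc d v u) (cong (d *_) (*-comm v u)))

∃primeFactor : 1 < n → ∃ λ p → Prime p × p ∣ n
∃primeFactor {suc n} 1<n with factorise (suc n)
... | record { factors = [] ; isFactorisation = n≡1 } = contradiction 1<n (<-irrefl (sym n≡1))
... | record { factors = p ∷ ps ; isFactorisation = n≡pΠ ; factorsPrime = pp ∷ _ } =
  p , pp , subst (p ∣_) (sym n≡pΠ) (m∣m*n (product ps))

primePower⊎otherPrimeFactor : .{{NonZero n}} → Prime p →
  (∃ λ a → n ≡ p ^ a) ⊎ (∃ λ q → Prime q × q ≢ p × q ∣ n)
primePower⊎otherPrimeFactor {n} {p} pp with factorise n
... | record { factors = qs ; isFactorisation = n≡Π ; factorsPrime = qsPrime } =
  subst (λ m → (∃ λ a → m ≡ p ^ a) ⊎ (∃ λ q → Prime q × q ≢ p × q ∣ m))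
        (sym n≡Π) (split qsPrime)
  where
  split : ∀ {qs} → All Prime qs →
          (∃ λ a → product qs ≡ p ^ a) ⊎ (∃ λ q → Prime q × q ≢ p × q ∣ product qs)
  split [] = inj₁ (0 , refl)
  split (_∷_ {q} pq qsPrime) with q ≟ p | split qsPrime
  ... | no q≢p   | _                          = inj₂ (q , pq , q≢p , m∣m*n _)
  ... | yes refl | inj₁ (a , Π≡q^a)           = inj₁ (suc a , cong (q *_) Π≡q^a)
  ... | yes refl | inj₂ (r , pr , r≢p , r∣Π)  = inj₂ (r , pr , r≢p , ∣n⇒∣m*n q r∣Π)

^-monoʳ-∣ : ∀ p {i a} → i ≤ a → p ^ i ∣ p ^ a
^-monoʳ-∣ p {a = a} z≤n = 1∣ (p ^ a)
^-monoʳ-∣ p (s≤s i≤a)   = *-monoʳ-∣ p (^-monoʳ-∣ p i≤a)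

∣p^a⇒≡p^i : Prime p → ∀ a → u ∣ p ^ a → ∃ λ i → i ≤ a × u ≡ p ^ i
∣p^a⇒≡p^i pp zero u∣1 = 0 , z≤n , ∣1⇒≡1 u∣1
∣p^a⇒≡p^i {p} {u} pp (suc a) u∣p^1+a with p ∣? u
... | no p∤u =
  let i , i≤a , u≡p^i = ∣p^a⇒≡p^i pp a (coprime-divisor (prime∤⇒coprime pp p∤u) u∣p^1+a)
  in i , m≤n⇒m≤1+n i≤a , u≡p^i
... | yes (divides c refl) =
  let c∣p^a = *-cancelʳ-∣ {m = c} p {{prime⇒nonZero pp}}
                (subst (c * p ∣_) (*-comm p (p ^ a)) u∣p^1+a)
      i , i≤a , c≡p^i = ∣p^a⇒≡p^i pp a c∣p^a
  in suc i , s≤s i≤a , trans (cong (_* p) c≡p^i) (*-comm (p ^ i) p)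

properDivisor[p^i] : Prime p → ∀ i a → 0 < i → i < a → ProperDivisor (p ^ a) (p ^ i)
properDivisor[p^i] {p} pp i a 0<i i<a =
  ^-monoʳ-< p (prime>1 pp) {0} 0<i , ^-monoʳ-< p (prime>1 pp) i<a , ^-monoʳ-∣ p (<⇒≤ i<a)

properDivisor[p^a] : Prime p → ∀ a → ProperDivisor (p ^ a) u →
                     ∃ λ i → 0 < i × i < a × u ≡ p ^ i
properDivisor[p^a] {p} pp a (1<u , u<p^a , u∣p^a) with ∣p^a⇒≡p^i pp a u∣p^a
... | zero  , _     , refl = contradiction 1<u (<-irrefl refl)
... | suc i , 1+i≤a , refl =
  suc i , s≤s z≤n , ≤∧≢⇒< 1+i≤a (λ { refl → <-irrefl refl u<p^a }) , refl

p∣properDivisor[p^a] : Prime p → ∀ a → ProperDivisor (p ^ a) u → p ∣ u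
p∣properDivisor[p^a] {p} pp a pu with properDivisor[p^a] pp a pu
... | suc i , _ , _ , refl = m∣m*n (p ^ i)

properDivisor[p*q] : Prime p → Prime q → ProperDivisor (p * q) u → u ≡ p ⊎ u ≡ q
properDivisor[p*q] {p} {q} {u} pp pq (1<u , u<pq , u∣pq) with p ∣? u
... | yes (divides c refl)
  with prime⇒irreducible pq
         (*-cancelʳ-∣ {m = c} p {{prime⇒nonZero pp}} (subst (c * p ∣_) (*-comm p q) u∣pq))
...   | inj₁ refl = inj₁ (*-identityˡ p)
...   | inj₂ refl = contradiction (*-comm q p) (<⇒≢ u<pq)
properDivisor[p*q] {p} {q} {u} pp pq (1<u , u<pq , u∣pq) | no p∤u
  with prime⇒irreducible pq (coprime-divisor (prime∤⇒coprime pp p∤u) u∣pq)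
...   | inj₁ refl = contradiction 1<u (<-irrefl refl)
...   | inj₂ u≡q  = inj₂ u≡q

prime-properDivisor : Composite n → Prime p → p ∣ n → ProperDivisor n p
prime-properDivisor c pp p∣n =
  prime>1 pp ,
  ≤∧≢⇒< (∣⇒≤ {{composite⇒nonZero c}} p∣n) (λ { refl → composite⇒¬prime c pp }) ,
  p∣n

cofactor : ProperDivisor n u → Prime q → q ∣ u → ∃ λ h → ProperDivisor n h × n ≡ h * q
cofactor {n} {u} {q} (1<u , u<n , u∣n) pq q∣u =
  quotient q∣n ,
  (quotient>1 q∣n q<n , quotient-< q∣n {{prime⇒nonTrivial pq}} {{n≢0}} , quotient-∣ q∣n) ,
  m∣n⇒n≡quotient*m q∣n
  where
  q∣n : q ∣ n
  q∣n = ∣-trans q∣u u∣n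
  q<n : q < n
  q<n = ≤-<-trans (∣⇒≤ {{>-nonZero (<-trans z<s 1<u)}} q∣u) u<n
  n≢0 : NonZero n
  n≢0 = >-nonZero (<-trans z<s (<-trans 1<u u<n))

∣*cofactor : ∀ {h} → n ≡ h * q → q ∣ u → n ∣ u * h
∣*cofactor {q = q} {h = h} refl (divides c refl) =
  divides c (trans (*-assoc c q h) (cong (c *_) (*-comm q h)))

cofactors-adjacent : ∀ {a b r} → Prime q → Prime r → n ≡ a * q → n ≡ b * r → a ≢ b → n ∣ a * b
cofactors-adjacent {q} {n} {a} {b} {r} pq pr n≡aq n≡br a≢b
  with euclidsLemma b r pq (subst (q ∣_) n≡br (divides a n≡aq))
... | inj₁ q∣b = subst (n ∣_) (*-comm b a) (∣*cofactor n≡aq q∣b)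
... | inj₂ q∣r with prime∣prime⇒≡ pq pr q∣r
...   | refl = contradiction (*-cancelʳ-≡ a b q {{prime⇒nonZero pq}} (trans (sym n≡aq) n≡br)) a≢b

reachable≤3 : ProperDivisor n u → ProperDivisor n v → Reachable n 3 u v
reachable≤3 {n} {u} {v} pu@(1<u , _) pv@(1<v , _) =
  let q , pq , q∣u  = ∃primeFactor 1<u
      r , pr , r∣v  = ∃primeFactor 1<v
      a , pa , n≡aq = cofactor pu pq q∣u
      b , pb , n≡br = cofactor pv pr r∣v
  in reachable-cons pu (λ _ → ∣*cofactor n≡aq q∣u)
       (reachable-cons pa (cofactors-adjacent pq pr n≡aq n≡br)
         (reachable-cons pb (λ _ → subst (n ∣_) (*-comm v b) (∣*cofactor n≡br r∣v))
           (reachable-refl pv)))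

reachable≤2[p^a] : Prime p → ∀ a → ProperDivisor (p ^ a) u → ProperDivisor (p ^ a) v →
                   Reachable (p ^ a) 2 u v
reachable≤2[p^a] {p} {u} {v} pp a pu pv =
  let p∣u = p∣properDivisor[p^a] pp a pu
      h , ph , p^a≡hp = cofactor pu pp p∣u
  in reachable-cons pu (λ _ → ∣*cofactor p^a≡hp p∣u)
       (reachable-cons ph (λ _ → subst (p ^ a ∣_) (*-comm v h)
                                   (∣*cofactor p^a≡hp (p∣properDivisor[p^a] pp a pv)))
         (reachable-refl pv))

coprime-adjacent⇒≡* : Coprime u v → u ∣ n → v ∣ n → Adj n u v → n ≡ u * v
coprime-adjacent⇒≡* coprime u∣n v∣n (_ , _ , _ , n∣uv) =
  ∣-antisym n∣uv (coprime⇒*∣ coprime u∣n v∣n)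

coprime⇒¬commonNeighbour : Coprime u v → Adj n u w → Adj n w v → ⊥
coprime⇒¬commonNeighbour {v = v} {n = n} {w = w} coprime
  (_ , (1<w , w<n , _) , _ , n∣uw) (_ , _ , _ , n∣wv) =
  <⇒≱ w<n (∣⇒≤ {{>-nonZero (<-trans z<s 1<w)}} n∣w)
  where
  n∣w : n ∣ w
  n∣w = coprime-factors coprime (n∣uw , subst (n ∣_) (*-comm w v) n∣wv)

coprime⇒distance≥3 : Coprime u v → ProperDivisor n u → ProperDivisor n v → n ≢ u * v →
                     ∀ j → j < 3 → ¬ Walk n u v j
coprime⇒distance≥3 coprime (1<u , _ , u∣n) (_ , _ , v∣n) n≢uv = λ where
  zero _ uv →
    <-irrefl (sym (coprime (∣-refl , ∣-reflexive (walk₀⇒≡ uv)))) 1<u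
  (suc zero) _ uv → n≢uv (coprime-adjacent⇒≡* coprime u∣n v∣n (walk₁⇒Adj uv))
  (suc (suc zero)) _ uv →
    let _ , uw , wv = walk₂⇒Adj² uv in coprime⇒¬commonNeighbour coprime uw wv
  (suc (suc (suc _))) (s≤s (s≤s (s≤s ())))

diameter[p^3] : Prime p → Diameter (p ^ 3) 1
diameter[p^3] {p} pp =
  singleEdge⇒diameter1 vertices (properDivisor[p^i] pp 1 3 z<s (s≤s (s≤s z≤n)))
    (properDivisor[p^i] pp 2 3 z<s ≤-refl) p≢p² (^-distribˡ-+-* p 1 2)
  where
  p≢p² : p ^ 1 ≢ p ^ 2
  p≢p² = <⇒≢ (^-monoʳ-< p (prime>1 pp) {1} ≤-refl)
  vertices : ProperDivisor (p ^ 3) u → u ≡ p ^ 1 ⊎ u ≡ p ^ 2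
  vertices pu with properDivisor[p^a] pp 3 pu
  ... | 1 , _ , _ , u≡p  = inj₁ u≡p
  ... | 2 , _ , _ , u≡p² = inj₂ u≡p²
  ... | suc (suc (suc _)) , _ , s≤s (s≤s (s≤s ())) , _

diameter[p*q] : Prime p → Prime q → p ≢ q → Diameter (p * q) 1
diameter[p*q] {p} {q} pp pq p≢q = singleEdge⇒diameter1 (properDivisor[p*q] pp pq) pdp pdq p≢q refl
  where
  pdp : ProperDivisor (p * q) p
  pdp = prime>1 pp , m<m*n p q {{prime⇒nonZero pp}} (prime>1 pq) , m∣m*n q
  pdq : ProperDivisor (p * q) q
  pdq = prime>1 pq , subst (q <_) (*-comm q p) (m<m*n q p {{prime⇒nonZero pq}} (prime>1 pp)) ,
        n∣m*n p

diameter[p^a] : Prime p → 4 ≤ a → Diameter (p ^ a) 2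
diameter[p^a] {p} {a} pp 4≤a = mkDiameter (λ _ _ → reachable≤2[p^a] pp a) pd¹ pd² noShorter
  where
  pd¹ : ProperDivisor (p ^ a) (p ^ 1)
  pd¹ = properDivisor[p^i] pp 1 a z<s (≤-trans (s≤s (s≤s z≤n)) 4≤a)
  pd² : ProperDivisor (p ^ a) (p ^ 2)
  pd² = properDivisor[p^i] pp 2 a z<s (≤-trans (s≤s (s≤s (s≤s z≤n))) 4≤a)
  noShorter : ∀ j → j < 2 → ¬ Walk (p ^ a) (p ^ 1) (p ^ 2) j
  noShorter zero _ w = <⇒≢ (^-monoʳ-< p (prime>1 pp) {1} ≤-refl) (walk₀⇒≡ w)
  noShorter (suc zero) _ w =
    let _ , _ , _ , p^a∣p³ = walk₁⇒Adj w
    in <⇒≱ (^-monoʳ-< p (prime>1 pp) 4≤a)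
           (∣⇒≤ {{m^n≢0 p 3 {{prime⇒nonZero pp}}}}
                (subst (p ^ a ∣_) (sym (^-distribˡ-+-* p 1 2)) p^a∣p³))
  noShorter (suc (suc _)) (s≤s (s≤s ()))

diameter[twoPrimes] : Composite n → Prime p → Prime q → p ≢ q → p ∣ n → q ∣ n → n ≢ p * q →
                      Diameter n 3
diameter[twoPrimes] {n} {p} {q} c pp pq p≢q p∣n q∣n n≢pq =
  mkDiameter (λ _ _ → reachable≤3) pdp pdq (coprime⇒distance≥3 coprime pdp pdq n≢pq)
  where
  pdp : ProperDivisor n p
  pdp = prime-properDivisor c pp p∣n
  pdq : ProperDivisor n q
  pdq = prime-properDivisor c pq q∣n
  coprime : Coprime p q
  coprime = prime∤⇒coprime pq (p≢q ∘ sym ∘ prime∣prime⇒≡ pq pp)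

compositeShape : Composite n →
  (∃ λ p → Prime p × n ≡ p ^ 2) ⊎ (∃ λ p → Prime p × n ≡ p ^ 3) ⊎
  (∃₂ λ p a → Prime p × 4 ≤ a × n ≡ p ^ a) ⊎
  (∃₂ λ p q → Prime p × Prime q × p ≢ q × p ∣ n × q ∣ n)
compositeShape {n} c with ∃primeFactor (nonTrivial⇒n>1 n {{composite⇒nonTrivial c}})
... | p , pp , p∣n with primePower⊎otherPrimeFactor {{composite⇒nonZero c}} pp
...   | inj₂ (q , pq , q≢p , q∣n) = inj₂ (inj₂ (inj₂ (p , q , pp , pq , q≢p ∘ sym , p∣n , q∣n)))
...   | inj₁ (zero , refl) =
  contradiction (nonTrivial⇒n>1 1 {{composite⇒nonTrivial c}}) (<-irrefl refl)
...   | inj₁ (1 , refl) = contradiction (subst Prime (sym (*-identityʳ p)) pp) (composite⇒¬prime c)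
...   | inj₁ (2 , refl) = inj₁ (p , pp , refl)
...   | inj₁ (3 , refl) = inj₂ (inj₁ (p , pp , refl))
...   | inj₁ (a@(suc (suc (suc (suc _)))) , refl) =
  inj₂ (inj₂ (inj₁ (p , a , pp , s≤s (s≤s (s≤s (s≤s z≤n))) , refl)))

proposition2p9 : (n : ℕ) → Composite n →
    ¬ Σ ℕ (λ p → Prime p × n ≡ p ^ 2) →
    ((Σ ℕ (λ p → Prime p × n ≡ p ^ 3)
        ⊎ Σ ℕ (λ p → Σ ℕ (λ q → Prime p × Prime q × p ≢ q × n ≡ p * q)))
      → Diameter n 1)
    × (Σ ℕ (λ p → Σ ℕ (λ a → Prime p × 4 ≤ a × n ≡ p ^ a)) → Diameter n 2)
    × (¬ Σ ℕ (λ p → Prime p × n ≡ p ^ 3)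
      → ¬ Σ ℕ (λ p → Σ ℕ (λ q → Prime p × Prime q × p ≢ q × n ≡ p * q))
      → ¬ Σ ℕ (λ p → Σ ℕ (λ a → Prime p × 4 ≤ a × n ≡ p ^ a))
      → Diameter n 3)
proposition2p9 n c ¬square =
  (λ { (inj₁ (p , pp , refl))                → diameter[p^3] pp
     ; (inj₂ (p , q , pp , pq , p≢q , refl)) → diameter[p*q] pp pq p≢q }) ,
  (λ { (p , a , pp , 4≤a , refl) → diameter[p^a] pp 4≤a }) ,
  λ ¬cube ¬semiprime ¬power → case compositeShape c of λ where
    (inj₁ square)              → ⊥-elim (¬square square)
    (inj₂ (inj₁ cube))         → ⊥-elim (¬cube cube)
    (inj₂ (inj₂ (inj₁ power))) → ⊥-elim (¬power power)
    (inj₂ (inj₂ (inj₂ (p , q , pp , pq , p≢q , p∣n , q∣n)))) →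
      diameter[twoPrimes] c pp pq p≢q p∣n q∣n
        λ n≡pq → ¬semiprime (p , q , pp , pq , p≢q , n≡pq)
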